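{- Let $n$ be a positive integer. If $G$ is a Deza graph with parameters $(4n,n+2,n-2,2)$ or $(4n,3n-2,3n-6,2n-2)$ and $G$ is not a divisible design graph, then $n\le 8$.
   Context: A Deza graph with parameters $(v,k,b,a)$, $b\ge a$, is a $k$-regular graph on $v$ vertices in which any two distinct vertices have either $b$ or $a$ common neighbours. A divisible design graph with parameters $(v,k,\lambda_1,\lambda_2,m,n)$ is a $k$-regular graph on $v=mn$ vertices whose vertex set can be partitioned into $m$ classes of size $n$ such that any two distinct vertices in the same class have exactly $\lambda_1$ common neighbours and any two vertices in different classes have exactly $\lambda_2$ common neighbours; "$G$ is a divisible design graph" means it is one for some such parameters and partition. -}

module Defs where

open import Data.Nat using (ℕ; zero; suc; _+_; _*_; _≤_)
open import Data.Bool using (Bool; true; false; if_then_else_; _∧_)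
open import Data.Fin using (Fin; zero; suc; _≟_)
open import Data.Sum using (_⊎_)
open import Data.Product using (Σ; ∃; _×_)
open import Relation.Nullary using (¬_)
open import Relation.Nullary.Decidable using (⌊_⌋)
open import Relation.Binary.PropositionalEquality using (_≡_)

count : ∀ {v} → (Fin v → Bool) → ℕ
count {zero}  f = 0
count {suc v} f = (if f zero then 1 else 0) + count (λ i → f (suc i))

record Graph (v : ℕ) : Set where
  field
    adj    : Fin v → Fin v → Bool
    symm   : ∀ x y → adj x y ≡ adj y x
    irrefl : ∀ x → adj x x ≡ false
open Graph public

degree : ∀ {v} → Graph v → Fin v → ℕ
degree G x = count (λ z → adj G x z)

common : ∀ {v} → Graph v → Fin v → Fin v → ℕ
common G x y = count (λ z → adj G x z ∧ adj G y z)

Regular : ∀ {v} → Graph v → ℕ → Set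
Regular G k = ∀ x → degree G x ≡ k

IsDeza : ∀ {v} → Graph v → ℕ → ℕ → ℕ → Set
IsDeza {v} G k b a =
  (a ≤ b) × Regular G k ×
  (∀ x y → ¬ (x ≡ y) → (common G x y ≡ b) ⊎ (common G x y ≡ a))

IsDDGWith : ∀ {v} → Graph v → ℕ → ℕ → ℕ → (m n : ℕ) → Set
IsDDGWith {v} G k λ₁ λ₂ m n =
  (v ≡ m * n) × Regular G k ×
  Σ (Fin v → Fin m) λ cls →
    (∀ c → count (λ y → ⌊ cls y ≟ c ⌋) ≡ n) ×
    (∀ x y → ¬ (x ≡ y) → cls x ≡ cls y → common G x y ≡ λ₁) ×
    (∀ x y → ¬ (cls x ≡ cls y) → common G x y ≡ λ₂)

IsDDG : ∀ {v} → Graph v → Set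
IsDDG {v} G = ∃ λ k → ∃ λ λ₁ → ∃ λ λ₂ → ∃ λ m → ∃ λ n → IsDDGWith G k λ₁ λ₂ m n

-- Call x ≠ y close if they have b common neighbours.  Two vertices close to a third w
-- share at least 2b - k neighbours (inclusion-exclusion inside the neighbourhood of w),
-- so when k + a < 2b closeness, together with equality, is an equivalence relation.
-- Counting the paths x - z - y from a fixed x gives k² = k + bβ + aγ, where β and γ count
-- the vertices close to and far from x; since β + γ = v - 1 and a < b this determines β,
-- and in both families with n ≥ 9 every class has exactly n vertices.  Three pairwise far
-- vertices then cut the 4n vertices into four classes of size n, which makes G a
-- divisible design graph.  In both families k + a < 2b is equivalent to n > 8.
module Submission where

open import Defs
open import Data.Nat as ℕ using (ℕ; zero; suc; _+_; _*_; _∸_; _≤_; _<_; z≤n; z<s; _≤?_)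
open import Data.Nat.Properties
open import Data.Nat.Tactic.RingSolver using (solve)
open import Data.Bool using (Bool; true; false; T; T?; not; _∧_; _∨_; if_then_else_)
open import Data.Bool.Properties using (∧-comm; ∧-idem; ∨-inverseˡ; T-∨)
open import Data.Fin as Fin using (Fin; zero; suc)
open import Data.Fin.Patterns using (0F; 1F; 2F; 3F)
open import Data.List using ([]; _∷_)
open import Data.Product using (∃; _,_; proj₁; proj₂)
open import Data.Sum using (_⊎_; inj₁; inj₂; [_,_])
open import Data.Empty using (⊥-elim)
open import Function using (_∘_; flip; id)
open import Function.Bundles using (Equivalence)
open import Level using (0ℓ)
open import Relation.Nullary using (¬_; yes; no; contradiction)
open import Relation.Nullary.Decidable using (⌊_⌋; _⊎-dec_; toWitness; fromWitness; isYes≗does)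
open import Relation.Binary using (Rel; Decidable; IsEquivalence)
open import Relation.Binary.PropositionalEquality
  using (_≡_; _≢_; refl; sym; trans; cong; cong₂; subst; subst₂; _≗_; module ≡-Reasoning)
open import Algebra.Properties.Semiring.Sum +-*-semiring
  using (sum-syntax; sum-cong-≗; ∑-distrib-+; ∑-comm; *-distribˡ-sum; *-distribʳ-sum)

𝟙 : Bool → ℕ
𝟙 b = if b then 1 else 0

count≡∑ : ∀ {v} (p : Fin v → Bool) → count p ≡ ∑[ i < v ] 𝟙 (p i)
count≡∑ {zero}  p = refl
count≡∑ {suc v} p = cong (𝟙 (p zero) +_) (count≡∑ (p ∘ suc))

count+count≡∑ : ∀ {v} (p q : Fin v → Bool) →
  count p + count q ≡ ∑[ i < v ] (𝟙 (p i) + 𝟙 (q i))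
count+count≡∑ p q =
  trans (cong₂ _+_ (count≡∑ p) (count≡∑ q)) (sym (∑-distrib-+ (𝟙 ∘ p) (𝟙 ∘ q)))

∑-mono-≤ : ∀ {v} {f g : Fin v → ℕ} → (∀ i → f i ≤ g i) → ∑[ i < v ] f i ≤ ∑[ i < v ] g i
∑-mono-≤ {zero}  f≤g = z≤n
∑-mono-≤ {suc v} f≤g = +-mono-≤ (f≤g zero) (∑-mono-≤ (f≤g ∘ suc))

∑-mono-< : ∀ {v} {f g : Fin v → ℕ} → (∀ i → f i ≤ g i) →
  ∀ j → f j < g j → ∑[ i < v ] f i < ∑[ i < v ] g i
∑-mono-< f≤g zero    fj<gj = +-mono-<-≤ fj<gj (∑-mono-≤ (f≤g ∘ suc))
∑-mono-< f≤g (suc j) fj<gj = +-mono-≤-< (f≤g zero) (∑-mono-< (f≤g ∘ suc) j fj<gj)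

count-cong : ∀ {v} {p q : Fin v → Bool} → p ≗ q → count p ≡ count q
count-cong {p = p} {q} p≗q =
  trans (count≡∑ p) (trans (sum-cong-≗ (cong 𝟙 ∘ p≗q)) (sym (count≡∑ q)))

count-true : ∀ {v} → count {v} (λ _ → true) ≡ v
count-true {zero}  = refl
count-true {suc v} = cong suc (count-true {v})

count-false : ∀ {v} → count {v} (λ _ → false) ≡ 0
count-false {zero}  = refl
count-false {suc v} = count-false {v}

count-≟ : ∀ {v} (x : Fin v) → count (λ y → ⌊ x Fin.≟ y ⌋) ≡ 1
count-≟ {suc v} zero    = cong suc (count-false {v})
count-≟ {suc v} (suc x) = trans (count-cong ⌊suc≟suc⌋) (count-≟ x)
  where
  -- ⌊_⌋ does not compute through the map′ in Fin's _≟_, but does does.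
  ⌊suc≟suc⌋ : ∀ y → ⌊ suc x Fin.≟ suc y ⌋ ≡ ⌊ x Fin.≟ y ⌋
  ⌊suc≟suc⌋ y = trans (isYes≗does (suc x Fin.≟ suc y)) (sym (isYes≗does (x Fin.≟ y)))

count-∨ : ∀ {v} {p q : Fin v → Bool} → (∀ i → T (p i) → ¬ T (q i)) →
  count (λ i → p i ∨ q i) ≡ count p + count q
count-∨ {p = p} {q} disjoint = begin
  count (λ i → p i ∨ q i)           ≡⟨ count≡∑ (λ i → p i ∨ q i) ⟩
  ∑[ i < _ ] 𝟙 (p i ∨ q i)          ≡⟨ sum-cong-≗ (λ i → 𝟙-∨ (disjoint i)) ⟩
  ∑[ i < _ ] (𝟙 (p i) + 𝟙 (q i))    ≡⟨ count+count≡∑ p q ⟨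
  count p + count q                 ∎
  where
  open ≡-Reasoning
  𝟙-∨ : ∀ {x y} → (T x → ¬ T y) → 𝟙 (x ∨ y) ≡ 𝟙 x + 𝟙 y
  𝟙-∨ {true}  {true}  x⇒¬y = contradiction _ (x⇒¬y _)
  𝟙-∨ {true}  {false} _    = refl
  𝟙-∨ {false}         _    = refl

count-not : ∀ {v} (p : Fin v → Bool) → count (not ∘ p) + count p ≡ v
count-not {v} p = begin
  count (not ∘ p) + count p          ≡⟨ count-∨ {p = not ∘ p} (λ i → not-disjoint (p i)) ⟨
  count (λ i → not (p i) ∨ p i)      ≡⟨ count-cong (∨-inverseˡ ∘ p) ⟩
  count {v} (λ _ → true)             ≡⟨ count-true ⟩
  v                                  ∎
  where
  open ≡-Reasoning
  not-disjoint : ∀ x → T (not x) → ¬ T x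
  not-disjoint false _ ()

count-⊆-split : ∀ {v} {p q : Fin v → Bool} → (∀ i → T (q i) → T (p i)) →
  count p ≡ count q + count (λ i → p i ∧ not (q i))
count-⊆-split {p = p} {q} q⊆p =
  trans (count-cong (λ i → split (q⊆p i))) (count-∨ {p = q} (λ i → disjoint))
  where
  split : ∀ {x y} → (T y → T x) → x ≡ y ∨ (x ∧ not y)
  split {true}  {true}  _ = refl
  split {true}  {false} _ = refl
  split {false} {true}  y⇒x = contradiction (y⇒x _) (λ ())
  split {false} {false} _ = refl
  disjoint : ∀ {x y} → T y → ¬ T (x ∧ not y)
  disjoint {true}  {true}  _ ()
  disjoint {false} {true}  _ ()

count<⇒∃¬ : ∀ {v} (p : Fin v → Bool) → count p < v → ∃ λ i → ¬ T (p i)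
count<⇒∃¬ {suc v} p count<v with p zero in p₀
... | false = zero , subst T p₀
... | true  with count<⇒∃¬ (p ∘ suc) (≤-pred count<v)
...   | i , ¬pi = suc i , ¬pi

count-⊂ : ∀ {v} {p q : Fin v → Bool} → (∀ i → T (p i) → T (q i)) →
  ∀ j → ¬ T (p j) → T (q j) → count p < count q
count-⊂ {p = p} {q} p⊆q j ¬pj qj = begin-strict
  count p              ≡⟨ count≡∑ p ⟩
  ∑[ i < _ ] 𝟙 (p i)   <⟨ ∑-mono-< (λ i → 𝟙-mono (p⊆q i)) j (𝟙-< ¬pj qj) ⟩
  ∑[ i < _ ] 𝟙 (q i)   ≡⟨ count≡∑ q ⟨
  count q              ∎
  where
  open ≤-Reasoning
  𝟙-mono : ∀ {x y} → (T x → T y) → 𝟙 x ≤ 𝟙 y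
  𝟙-mono {false}          _   = z≤n
  𝟙-mono {true}  {true}   _   = ≤-refl
  𝟙-mono {true}  {false}  x⇒y = contradiction (x⇒y _) (λ ())
  𝟙-< : ∀ {x y} → ¬ T x → T y → 𝟙 x < 𝟙 y
  𝟙-< {false} {true} _ _ = ≤-refl
  𝟙-< {true}         ¬x  = contradiction _ ¬x

⊆∧count≥⇒⊇ : ∀ {v} {p q : Fin v → Bool} → (∀ i → T (p i) → T (q i)) →
  count q ≤ count p → ∀ j → T (q j) → T (p j)
⊆∧count≥⇒⊇ {p = p} p⊆q q≤p j qj with T? (p j)
... | yes pj  = pj
... | no  ¬pj = contradiction q≤p (<⇒≱ (count-⊂ p⊆q j ¬pj qj))

count-∧-∧ : ∀ {v} (w p q : Fin v → Bool) →
  count (λ i → w i ∧ p i) + count (λ i → w i ∧ q i) ≤ count w + count (λ i → p i ∧ q i)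
count-∧-∧ w p q = begin
  count (λ i → w i ∧ p i) + count (λ i → w i ∧ q i)
    ≡⟨ count+count≡∑ (λ i → w i ∧ p i) (λ i → w i ∧ q i) ⟩
  ∑[ i < _ ] (𝟙 (w i ∧ p i) + 𝟙 (w i ∧ q i))
    ≤⟨ ∑-mono-≤ (λ i → pointwise (w i) (p i) (q i)) ⟩
  ∑[ i < _ ] (𝟙 (w i) + 𝟙 (p i ∧ q i))
    ≡⟨ count+count≡∑ w (λ i → p i ∧ q i) ⟨
  count w + count (λ i → p i ∧ q i) ∎
  where
  open ≤-Reasoning
  pointwise : ∀ x y z → 𝟙 (x ∧ y) + 𝟙 (x ∧ z) ≤ 𝟙 x + 𝟙 (y ∧ z)
  pointwise false _     _     = z≤n
  pointwise true  false false = z≤n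
  pointwise true  false true  = ≤-refl
  pointwise true  true  false = ≤-refl
  pointwise true  true  true  = ≤-refl

module _ {v} (G : Graph v) where

  common-sym : ∀ x y → common G x y ≡ common G y x
  common-sym x y = count-cong (λ z → ∧-comm (adj G x z) (adj G y z))

  common-self : ∀ x → common G x x ≡ degree G x
  common-self x = count-cong (λ z → ∧-idem (adj G x z))

  common-triangle : ∀ w p q → common G w p + common G w q ≤ degree G w + common G p q
  common-triangle w p q = count-∧-∧ (adj G w) (adj G p) (adj G q)

  ∑-common : ∀ {k} → Regular G k → ∀ x → ∑[ y < v ] common G x y ≡ k * k
  ∑-common {k} regular x = begin
    ∑[ y < v ] common G x y
      ≡⟨ sum-cong-≗ common≡∑ ⟩
    ∑[ y < v ] ∑[ z < v ] (A x z * A y z)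
      ≡⟨ ∑-comm (λ y z → A x z * A y z) ⟩
    ∑[ z < v ] ∑[ y < v ] (A x z * A y z)
      ≡⟨ sum-cong-≗ (λ z → *-distribˡ-sum (A x z) (λ y → A y z)) ⟨
    ∑[ z < v ] (A x z * ∑[ y < v ] A y z)
      ≡⟨ sum-cong-≗ (λ z → cong (A x z *_) (∑-column z)) ⟩
    ∑[ z < v ] (A x z * k)
      ≡⟨ *-distribʳ-sum k (A x) ⟨
    ∑[ z < v ] A x z * k
      ≡⟨ cong (_* k) (trans (sym (count≡∑ (adj G x))) (regular x)) ⟩
    k * k ∎
    where
    open ≡-Reasoning
    A : Fin v → Fin v → ℕ
    A x z = 𝟙 (adj G x z)
    𝟙-∧ : ∀ p q → 𝟙 (p ∧ q) ≡ 𝟙 p * 𝟙 q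
    𝟙-∧ false _     = refl
    𝟙-∧ true  false = refl
    𝟙-∧ true  true  = refl
    common≡∑ : ∀ y → common G x y ≡ ∑[ z < v ] (A x z * A y z)
    common≡∑ y = trans (count≡∑ (λ z → adj G x z ∧ adj G y z))
                       (sum-cong-≗ (λ z → 𝟙-∧ (adj G x z) (adj G y z)))
    ∑-column : ∀ z → ∑[ y < v ] A y z ≡ k
    ∑-column z = begin
      ∑[ y < v ] A y z ≡⟨ sum-cong-≗ (λ y → cong 𝟙 (symm G y z)) ⟩
      ∑[ y < v ] A z y ≡⟨ count≡∑ (adj G z) ⟨
      degree G z       ≡⟨ regular z ⟩
      k                ∎

∑-linear₃ : ∀ {v} (k b a : ℕ) (p q r : Fin v → Bool) →
  ∑[ i < v ] (k * 𝟙 (p i) + b * 𝟙 (q i) + a * 𝟙 (r i)) ≡ k * count p + b * count q + a * count r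
∑-linear₃ k b a p q r = begin
  ∑[ i < _ ] (k * 𝟙 (p i) + b * 𝟙 (q i) + a * 𝟙 (r i))
    ≡⟨ ∑-distrib-+ (λ i → k * 𝟙 (p i) + b * 𝟙 (q i)) (λ i → a * 𝟙 (r i)) ⟩
  ∑[ i < _ ] (k * 𝟙 (p i) + b * 𝟙 (q i)) + ∑[ i < _ ] (a * 𝟙 (r i))
    ≡⟨ cong (_+ ∑[ i < _ ] (a * 𝟙 (r i))) (∑-distrib-+ (λ i → k * 𝟙 (p i)) (λ i → b * 𝟙 (q i))) ⟩
  ∑[ i < _ ] (k * 𝟙 (p i)) + ∑[ i < _ ] (b * 𝟙 (q i)) + ∑[ i < _ ] (a * 𝟙 (r i))
    ≡⟨ cong₂ _+_ (cong₂ _+_ (scale k p) (scale b q)) (scale a r) ⟨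
  k * count p + b * count q + a * count r ∎
  where
  open ≡-Reasoning
  scale : ∀ c s → c * count s ≡ ∑[ i < _ ] (c * 𝟙 (s i))
  scale c s = trans (cong (c *_) (count≡∑ s)) (*-distribˡ-sum c (𝟙 ∘ s))

linear-split-unique : ∀ {a b β γ β′ γ′} → a < b → β + γ ≡ β′ + γ′ →
  b * β + a * γ ≡ b * β′ + a * γ′ → β ≡ β′
linear-split-unique {a} {β = β} {γ} {β′} {γ′} a<b sums equation with m≤n⇒∃[o]m+o≡n a<b
... | d , refl = *-cancelˡ-≡ β β′ (suc d) (+-cancelˡ-≡ (a * (β + γ)) _ _ (begin
  a * (β + γ) + suc d * β    ≡⟨ solve (a ∷ d ∷ β ∷ γ ∷ []) ⟩
  (suc a + d) * β + a * γ    ≡⟨ equation ⟩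
  (suc a + d) * β′ + a * γ′  ≡⟨ solve (a ∷ d ∷ β′ ∷ γ′ ∷ []) ⟩
  a * (β′ + γ′) + suc d * β′ ≡⟨ cong (λ s → a * s + suc d * β′) sums ⟨
  a * (β + γ) + suc d * β′   ∎))
  where open ≡-Reasoning

module DezaClasses {v} {G : Graph v} {k b a : ℕ} (regular : Regular G k)
  (two-valued : ∀ x y → x ≢ y → common G x y ≡ b ⊎ common G x y ≡ a) where

  SameClass : Rel (Fin v) 0ℓ
  SameClass x y = x ≡ y ⊎ common G x y ≡ b

  _≈?_ : Decidable SameClass
  x ≈? y = x Fin.≟ y ⊎-dec common G x y ℕ.≟ b

  β γ : Fin v → ℕ
  β x = count (λ y → ⌊ x ≈? y ⌋ ∧ not ⌊ x Fin.≟ y ⌋)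
  γ x = count (λ y → not ⌊ x ≈? y ⌋)

  class-size : ∀ x → count (λ y → ⌊ x ≈? y ⌋) ≡ suc (β x)
  class-size x = begin
    count (λ y → ⌊ x ≈? y ⌋)           ≡⟨ count-⊆-split {q = λ y → ⌊ x Fin.≟ y ⌋} x≡y⇒x≈y ⟩
    count (λ y → ⌊ x Fin.≟ y ⌋) + β x  ≡⟨ cong (_+ β x) (count-≟ x) ⟩
    suc (β x)                          ∎
    where
    open ≡-Reasoning
    x≡y⇒x≈y : ∀ y → T ⌊ x Fin.≟ y ⌋ → T ⌊ x ≈? y ⌋
    x≡y⇒x≈y y = fromWitness ∘ inj₁ ∘ toWitness

  β+γ : ∀ x → suc (β x + γ x) ≡ v
  β+γ x = begin
    suc (β x) + γ x                   ≡⟨ +-comm (suc (β x)) (γ x) ⟩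
    γ x + suc (β x)                   ≡⟨ cong (γ x +_) (class-size x) ⟨
    γ x + count (λ y → ⌊ x ≈? y ⌋)    ≡⟨ count-not (λ y → ⌊ x ≈? y ⌋) ⟩
    v                                 ∎
    where open ≡-Reasoning

  common-by-class : ∀ x y → common G x y ≡
    k * 𝟙 ⌊ x Fin.≟ y ⌋ + b * 𝟙 (⌊ x ≈? y ⌋ ∧ not ⌊ x Fin.≟ y ⌋) + a * 𝟙 (not ⌊ x ≈? y ⌋)
  common-by-class x y with x Fin.≟ y | x ≈? y
  ... | yes refl | yes _          = trans (common-self G x) (trans (regular x) (solve (k ∷ b ∷ a ∷ [])))
  ... | yes refl | no  x≉x        = contradiction (inj₁ refl) x≉x
  ... | no  x≢y  | yes (inj₁ x≡y) = contradiction x≡y x≢y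
  ... | no  x≢y  | yes (inj₂ c≡b) = trans c≡b (solve (k ∷ b ∷ a ∷ []))
  ... | no  x≢y  | no  x≉y        with two-valued x y x≢y
  ...   | inj₁ c≡b = contradiction (inj₂ c≡b) x≉y
  ...   | inj₂ c≡a = trans c≡a (solve (k ∷ b ∷ a ∷ []))

  counting-equation : ∀ x → k * k ≡ k + b * β x + a * γ x
  counting-equation x = begin
    k * k                                        ≡⟨ ∑-common G regular x ⟨
    ∑[ y < v ] common G x y                      ≡⟨ sum-cong-≗ (common-by-class x) ⟩
    _                                            ≡⟨ ∑-linear₃ k b a (λ y → ⌊ x Fin.≟ y ⌋) _ _ ⟩
    k * count (λ y → ⌊ x Fin.≟ y ⌋) + b * β x + a * γ x
                                                 ≡⟨ cong (λ c → k * c + b * β x + a * γ x) (count-≟ x) ⟩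
    k * 1 + b * β x + a * γ x                    ≡⟨ cong (λ c → c + b * β x + a * γ x) (*-identityʳ k) ⟩
    k + b * β x + a * γ x                        ∎
    where open ≡-Reasoning

  module _ (gap : k + a < b + b) where

    b-pairs-closed : ∀ w p q → common G w p ≡ b → common G w q ≡ b → p ≢ q → common G p q ≡ b
    b-pairs-closed w p q wp≡b wq≡b p≢q with two-valued p q p≢q
    ... | inj₁ pq≡b = pq≡b
    ... | inj₂ pq≡a = contradiction
      (subst₂ _≤_ (cong₂ _+_ wp≡b wq≡b) (cong₂ _+_ (regular w) pq≡a) (common-triangle G w p q))
      (<⇒≱ gap)

    sameClass-isEquivalence : IsEquivalence SameClass
    sameClass-isEquivalence = record
      { refl  = inj₁ refl
      ; sym   = ≈-sym
      ; trans = ≈-trans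
      }
      where
      ≈-sym : ∀ {x y} → SameClass x y → SameClass y x
      ≈-sym         (inj₁ x≡y) = inj₁ (sym x≡y)
      ≈-sym {x} {y} (inj₂ xy≡b) = inj₂ (trans (common-sym G y x) xy≡b)
      ≈-trans : ∀ {x y z} → SameClass x y → SameClass y z → SameClass x z
      ≈-trans (inj₁ refl) y≈z        = y≈z
      ≈-trans x≈y         (inj₁ refl) = x≈y
      ≈-trans {x} {y} {z} (inj₂ xy≡b) (inj₂ yz≡b) with x Fin.≟ z
      ... | yes x≡z = inj₁ x≡z
      ... | no  x≢z = inj₂ (b-pairs-closed y x z (trans (common-sym G y x) xy≡b) yz≡b x≢z)

  class-size-determined : a < b → ∀ {β′ γ′} → suc (β′ + γ′) ≡ v → k * k ≡ k + b * β′ + a * γ′ →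
    ∀ x → count (λ y → ⌊ x ≈? y ⌋) ≡ suc β′
  class-size-determined a<b {β′} {γ′} size equation x =
    trans (class-size x) (cong suc (linear-split-unique a<b sizes coefficients))
    where
    sizes : β x + γ x ≡ β′ + γ′
    sizes = suc-injective (trans (β+γ x) (sym size))
    coefficients : b * β x + a * γ x ≡ b * β′ + a * γ′
    coefficients = +-cancelˡ-≡ k _ _ (begin
      k + (b * β x + a * γ x) ≡⟨ +-assoc k _ _ ⟨
      k + b * β x + a * γ x   ≡⟨ counting-equation x ⟨
      k * k                   ≡⟨ equation ⟩
      k + b * β′ + a * γ′     ≡⟨ +-assoc k _ _ ⟩
      k + (b * β′ + a * γ′)   ∎)
      where open ≡-Reasoning

classOf : Bool → Bool → Bool → Fin 4
classOf true  _     _     = 0F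
classOf false true  _     = 1F
classOf false false true  = 2F
classOf false false false = 3F

inClass : Fin 4 → Bool → Bool → Bool → Bool
inClass 0F p q r = p
inClass 1F p q r = not p ∧ q
inClass 2F p q r = not p ∧ not q ∧ r
inClass 3F p q r = not (p ∨ q ∨ r)

classOf-≟ : ∀ p q r c → ⌊ classOf p q r Fin.≟ c ⌋ ≡ inClass c p q r
classOf-≟ true  _     _     0F = refl
classOf-≟ true  _     _     1F = refl
classOf-≟ true  _     _     2F = refl
classOf-≟ true  _     _     3F = refl
classOf-≟ false true  _     0F = refl
classOf-≟ false true  _     1F = refl
classOf-≟ false true  _     2F = refl
classOf-≟ false true  _     3F = refl
classOf-≟ false false true  0F = refl
classOf-≟ false false true  1F = refl
classOf-≟ false false true  2F = refl
classOf-≟ false false true  3F = refl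
classOf-≟ false false false 0F = refl
classOf-≟ false false false 1F = refl
classOf-≟ false false false 2F = refl
classOf-≟ false false false 3F = refl

not-∧-absorb : ∀ {p q} → (T q → ¬ T p) → not p ∧ q ≡ q
not-∧-absorb {false}         _     = refl
not-∧-absorb {true}  {false} _     = refl
not-∧-absorb {true}  {true}  q⇒¬p = contradiction _ (q⇒¬p _)

module FourClasses {P ℓ} {_~_ : Rel (Fin (4 * suc P)) ℓ}
  (isEquivalence : IsEquivalence _~_) (_~?_ : Decidable _~_)
  (class-size : ∀ x → count (λ y → ⌊ x ~? y ⌋) ≡ suc P) where

  open IsEquivalence isEquivalence using () renaming (sym to ~-sym; trans to ~-trans)

  _~ᵇ_ : Fin (4 * suc P) → Fin (4 * suc P) → Bool
  x ~ᵇ y = ⌊ x ~? y ⌋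

  ~ᵇ-resp : ∀ w {x y} → x ~ y → w ~ᵇ x ≡ w ~ᵇ y
  ~ᵇ-resp w {x} {y} x~y with w ~? x | w ~? y
  ... | yes _   | yes _   = refl
  ... | no  _   | no  _   = refl
  ... | yes w~x | no  w≁y = contradiction (~-trans w~x x~y) w≁y
  ... | no  w≁x | yes w~y = contradiction (~-trans w~y (~-sym x~y)) w≁x

  separated : ∀ {u w} → ¬ u ~ w → ∀ y → T (u ~ᵇ y) → ¬ T (w ~ᵇ y)
  separated u≁w y u~y w~y = u≁w (~-trans (toWitness u~y) (~-sym (toWitness w~y)))

  x₀ : Fin (4 * suc P)
  x₀ = zero

  one-class<v : count (x₀ ~ᵇ_) < 4 * suc P
  one-class<v = subst (_< 4 * suc P) (sym (class-size x₀)) (m<m+n (suc P) z<s)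

  x₁-exists : ∃ λ x₁ → ¬ T (x₀ ~ᵇ x₁)
  x₁-exists = count<⇒∃¬ (x₀ ~ᵇ_) one-class<v

  x₁ : Fin (4 * suc P)
  x₁ = proj₁ x₁-exists

  x₀≁x₁ : ¬ x₀ ~ x₁
  x₀≁x₁ = proj₂ x₁-exists ∘ fromWitness

  two-classes<v : count (λ y → x₀ ~ᵇ y ∨ x₁ ~ᵇ y) < 4 * suc P
  two-classes<v = begin-strict
    count (λ y → x₀ ~ᵇ y ∨ x₁ ~ᵇ y)   ≡⟨ count-∨ (separated x₀≁x₁) ⟩
    count (x₀ ~ᵇ_) + count (x₁ ~ᵇ_)    ≡⟨ cong₂ _+_ (class-size x₀) (class-size x₁) ⟩
    suc P + suc P                      <⟨ +-monoʳ-< (suc P) (m<m+n (suc P) z<s) ⟩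
    4 * suc P                          ∎
    where open ≤-Reasoning

  x₂-exists : ∃ λ x₂ → ¬ T (x₀ ~ᵇ x₂ ∨ x₁ ~ᵇ x₂)
  x₂-exists = count<⇒∃¬ (λ y → x₀ ~ᵇ y ∨ x₁ ~ᵇ y) two-classes<v

  x₂ : Fin (4 * suc P)
  x₂ = proj₁ x₂-exists

  x₀≁x₂ : ¬ x₀ ~ x₂
  x₀≁x₂ x₀~x₂ = proj₂ x₂-exists (Equivalence.from (T-∨ {x₀ ~ᵇ x₂}) (inj₁ (fromWitness x₀~x₂)))

  x₁≁x₂ : ¬ x₁ ~ x₂
  x₁≁x₂ x₁~x₂ = proj₂ x₂-exists (Equivalence.from (T-∨ {x₀ ~ᵇ x₂}) (inj₂ (fromWitness x₁~x₂)))

  classIndex : Fin (4 * suc P) → Fin 4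
  classIndex y = classOf (x₀ ~ᵇ y) (x₁ ~ᵇ y) (x₂ ~ᵇ y)

  classIndex-resp : ∀ {x y} → x ~ y → classIndex x ≡ classIndex y
  classIndex-resp {x} {y} x~y = trans
    (cong (λ p → classOf p (x₁ ~ᵇ x) (x₂ ~ᵇ x)) (~ᵇ-resp x₀ x~y))
    (cong₂ (classOf (x₀ ~ᵇ y)) (~ᵇ-resp x₁ x~y) (~ᵇ-resp x₂ x~y))

  inFirstThree : Fin (4 * suc P) → Bool
  inFirstThree y = x₀ ~ᵇ y ∨ x₁ ~ᵇ y ∨ x₂ ~ᵇ y

  three-classes : count inFirstThree ≡ suc P + (suc P + suc P)
  three-classes = begin
    count inFirstThree
      ≡⟨ count-∨ {p = x₀ ~ᵇ_} x₀-apart ⟩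
    count (x₀ ~ᵇ_) + count (λ y → x₁ ~ᵇ y ∨ x₂ ~ᵇ y)
      ≡⟨ cong (count (x₀ ~ᵇ_) +_) (count-∨ (separated x₁≁x₂)) ⟩
    count (x₀ ~ᵇ_) + (count (x₁ ~ᵇ_) + count (x₂ ~ᵇ_))
      ≡⟨ cong₂ _+_ (class-size x₀) (cong₂ _+_ (class-size x₁) (class-size x₂)) ⟩
    suc P + (suc P + suc P) ∎
    where
    open ≡-Reasoning
    x₀-apart : ∀ y → T (x₀ ~ᵇ y) → ¬ T (x₁ ~ᵇ y ∨ x₂ ~ᵇ y)
    x₀-apart y x₀~y x₁₂~y with Equivalence.to T-∨ x₁₂~y
    ... | inj₁ x₁~y = separated x₀≁x₁ y x₀~y x₁~y
    ... | inj₂ x₂~y = separated x₀≁x₂ y x₀~y x₂~y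

  classIndex-size : ∀ c → count (λ y → ⌊ classIndex y Fin.≟ c ⌋) ≡ suc P
  classIndex-size c = trans (count-cong (λ y → classOf-≟ (x₀ ~ᵇ y) (x₁ ~ᵇ y) (x₂ ~ᵇ y) c)) (inClass-size c)
    where
    inClass-size : ∀ c → count (λ y → inClass c (x₀ ~ᵇ y) (x₁ ~ᵇ y) (x₂ ~ᵇ y)) ≡ suc P
    inClass-size 0F = class-size x₀
    inClass-size 1F = trans (count-cong (λ y → not-∧-absorb (flip (separated x₀≁x₁ y)))) (class-size x₁)
    inClass-size 2F = trans (count-cong (λ y → trans
        (cong (not (x₀ ~ᵇ y) ∧_) (not-∧-absorb (flip (separated x₁≁x₂ y))))
        (not-∧-absorb (flip (separated x₀≁x₂ y)))))
      (class-size x₂)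
    inClass-size 3F = +-cancelʳ-≡ (suc P + (suc P + suc P)) _ _ (begin
      count (not ∘ inFirstThree) + (suc P + (suc P + suc P))
        ≡⟨ cong (count (not ∘ inFirstThree) +_) three-classes ⟨
      count (not ∘ inFirstThree) + count inFirstThree
        ≡⟨ count-not inFirstThree ⟩
      4 * suc P
        ≡⟨ solve (P ∷ []) ⟩
      suc P + (suc P + (suc P + suc P)) ∎)
      where open ≡-Reasoning

  -- The class of x lies inside its block and both have suc P elements.
  classIndex-reflects : ∀ {x y} → classIndex x ≡ classIndex y → x ~ y
  classIndex-reflects {x} {y} same = toWitness
    (⊆∧count≥⇒⊇ {p = x ~ᵇ_} {q = λ z → ⌊ classIndex z Fin.≟ classIndex x ⌋}
      (λ z x~z → fromWitness (sym (classIndex-resp (toWitness x~z))))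
      (≤-reflexive (trans (classIndex-size (classIndex x)) (sym (class-size x))))
      y (fromWitness (sym same)))

deza⇒ddg : ∀ {P} (G : Graph (4 * suc P)) {k b a} → IsDeza G k b a → a < b → k + a < b + b →
  k * k ≡ k + b * P + a * (3 * suc P) → IsDDG G
deza⇒ddg {P} G {k} {b} {a} (_ , regular , two-valued) a<b gap equation =
  k , b , a , 4 , suc P , refl , regular , classIndex , classIndex-size , same-class , other-class
  where
  open DezaClasses {G = G} regular two-valued
  open FourClasses (sameClass-isEquivalence gap) _≈?_
    (class-size-determined a<b {P} {3 * suc P} (solve (P ∷ [])) equation)

  same-class : ∀ x y → x ≢ y → classIndex x ≡ classIndex y → common G x y ≡ b
  same-class x y x≢y same =
    [ (λ x≡y → contradiction x≡y x≢y) , id ] (classIndex-reflects same)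

  other-class : ∀ x y → classIndex x ≢ classIndex y → common G x y ≡ a
  other-class x y different =
    [ (λ xy≡b → contradiction (classIndex-resp (inj₂ xy≡b)) different) , id ]
      (two-valued x y (different ∘ classIndex-resp ∘ inj₁))

≤-offset : ∀ {m n} d → m + d ≡ n → m ≤ n
≤-offset {m} d m+d≡n = subst (m ≤_) m+d≡n (m≤m+n m d)

family₁⇒ddg : ∀ m (G : Graph (4 * (9 + m))) → IsDeza G (9 + m + 2) (9 + m ∸ 2) 2 → IsDDG G
family₁⇒ddg m G deza = deza⇒ddg {P = 8 + m} G deza (≤-offset (4 + m) refl) gap equation
  where
  gap : 9 + m + 2 + 2 < 7 + m + (7 + m)
  gap = ≤-offset m (solve (m ∷ []))
  equation : (9 + m + 2) * (9 + m + 2) ≡ 9 + m + 2 + (7 + m) * (8 + m) + 2 * (3 * (9 + m))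
  equation = solve (m ∷ [])

family₂⇒ddg : ∀ m (G : Graph (4 * (9 + m))) →
  IsDeza G (3 * (9 + m) ∸ 2) (3 * (9 + m) ∸ 6) (2 * (9 + m) ∸ 2) → IsDDG G
family₂⇒ddg m G deza = deza⇒ddg {P = 8 + m} G deza′ a<b gap equation
  where
  deza′ : IsDeza G (25 + 3 * m) (21 + 3 * m) (16 + 2 * m)
  deza′ = subst₂ (λ t s → IsDeza G (t ∸ 2) (t ∸ 6) (s ∸ 2)) 3n≡ 2n≡ deza
    where
    3n≡ : 3 * (9 + m) ≡ 27 + 3 * m
    3n≡ = solve (m ∷ [])
    2n≡ : 2 * (9 + m) ≡ 18 + 2 * m
    2n≡ = solve (m ∷ [])
  a<b : 16 + 2 * m < 21 + 3 * m
  a<b = ≤-offset (4 + m) (solve (m ∷ []))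
  gap : 25 + 3 * m + (16 + 2 * m) < 21 + 3 * m + (21 + 3 * m)
  gap = ≤-offset m (solve (m ∷ []))
  equation : (25 + 3 * m) * (25 + 3 * m) ≡ 25 + 3 * m + (21 + 3 * m) * (8 + m) + (16 + 2 * m) * (3 * (9 + m))
  equation = solve (m ∷ [])

lemma1 : (n : ℕ) → 1 ≤ n → (G : Graph (4 * n)) →
    (IsDeza G (n + 2) (n ∸ 2) 2 ⊎ IsDeza G (3 * n ∸ 2) (3 * n ∸ 6) (2 * n ∸ 2)) →
    ¬ IsDDG G → n ≤ 8
lemma1 n _ G deza not-ddg with n ≤? 8
... | yes n≤8 = n≤8
... | no  n≰8 with m≤n⇒∃[o]m+o≡n (≰⇒> n≰8)
...   | m , refl = ⊥-elim (not-ddg ([ family₁⇒ddg m G , family₂⇒ddg m G ] deza))
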